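{- Let $n\neq 6$ be a positive integer such that either (i) $p_1^3\mid n$ for some prime $p_1$, or (ii) $p_1p_2\mid n$ or $2p_1\mid n$ for some distinct odd primes $p_1,p_2$. Then $\omega(M_n)\geq 3$.
   Context: For an integer $n\ge 0$, $M_n=2^n-1$ denotes the $n$-th Mersenne number. For a positive integer $m$, $\omega(m)$ denotes the number of distinct prime divisors of $m$. -}

module Defs where

open import Data.Nat using (ℕ; suc; _^_; _∸_)
open import Data.Nat.Divisibility using (_∣_; _∣?_)
open import Data.Nat.Primality using (Prime; prime?)
open import Data.List using (List; upTo; filter; length)
open import Data.Product using (_×_)
open import Relation.Nullary.Decidable using (_×-dec_)

M : ℕ → ℕ
M n = 2 ^ n ∸ 1

-- the list of prime divisors of m (every prime divisor of a positive m is ≤ m,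
-- so scanning 0 … m is exhaustive; each prime is listed once)
primeDivisors : ℕ → List ℕ
primeDivisors m = filter (λ p → prime? p ×-dec (p ∣? m)) (upTo (suc m))

ω : ℕ → ℕ
ω m = length (primeDivisors m)

{-# OPTIONS --safe #-}
-- Write y = M a.  Since M (a b) = y · G with G = 1 + (1 + y) + ⋯ + (1 + y)^(b-1) ≡ b (mod y),
-- a prime dividing both G and y divides b.  For an odd prime p moreover G ≡ p (mod p²) when
-- p ∣ y, so G always has a prime factor not dividing y, and along M p ∣ M p² ∣ M p³ a new prime
-- appears at each step.  For distinct odd primes p₁, p₂ the numbers M p₁, M p₂ are coprime, and
-- the cofactor R = M (p₁ p₂) / (M p₁ · M p₂) can share with them only p₂ and p₁, each to the
-- first power; as R > p₁ p₂, it has a third prime factor.  For 2p ∣ n with p ≠ 3 odd,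
-- M (2p) = y (y + 2) with y = M p, and y + 2 = 2^p + 1 is divisible by 3 but not by 9, giving
-- a prime of y, the prime 3 and a prime of (y + 2)/3.  The cases 8 ∣ n and 6 ∣ n (n ≠ 6, so
-- 12 ∣ n, 18 ∣ n or 2r ∣ n for a prime r ≥ 5) reduce to the factorisations of M 8, M 12, M 18.

module Submission where

open import Defs
open import Data.Nat
open import Data.Nat.Properties
open import Data.Nat.Divisibility
open import Data.Nat.Primality using (Prime; prime?; prime⇒irreducible; prime⇒nonTrivial; prime⇒nonZero; prime[2]; ¬prime[1])
open import Data.Nat.Primality.Factorisation using (factorise)
open import Data.Nat.ListAction using (product)
open import Data.Nat.Coprimality as Coprimality using (Coprime; coprime-Bézout; coprime-divisor)
open import Data.Nat.GCD using (module Bézout)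
open import Data.List using (List; []; _∷_; length)
open import Data.List.Relation.Unary.All using (_∷_)
open import Data.List.Properties using (length-removeAt′)
open import Data.List.Membership.Propositional using (_∈_)
open import Data.List.Membership.Propositional.Properties using (∈-filter⁺; ∈-upTo⁺)
open import Data.List.Relation.Unary.Any using (here; there; index; _─_)
open import Data.Product using (∃; _×_; _,_)
open import Data.Sum using (_⊎_; inj₁; inj₂)
open import Relation.Nullary.Decidable using (_×-dec_; yes; no; from-yes; from-no)
open import Relation.Nullary.Negation using (¬_; contradiction)
open import Relation.Binary.PropositionalEquality
open import Function using (_∘_; id)
open import Data.Nat.Tactic.RingSolver using (solve-∀)

module _ {A : Set} where

  ∈-─ : ∀ {x y} {xs : List A} (x∈xs : x ∈ xs) → y ∈ xs → y ≢ x → y ∈ (xs ─ x∈xs)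
  ∈-─ (here refl) (here refl)  y≢x = contradiction refl y≢x
  ∈-─ (here refl) (there y∈xs) _   = y∈xs
  ∈-─ (there _)   (here refl)  _   = here refl
  ∈-─ (there x∈xs) (there y∈xs) y≢x = there (∈-─ x∈xs y∈xs y≢x)

  length-─ : ∀ {x} {xs : List A} (x∈xs : x ∈ xs) → length xs ≡ suc (length (xs ─ x∈xs))
  length-─ {xs = xs} x∈xs = length-removeAt′ xs (index x∈xs)

  ∈⇒0<length : ∀ {x} {xs : List A} → x ∈ xs → 0 < length xs
  ∈⇒0<length (here _)  = z<s
  ∈⇒0<length (there _) = z<s

  3≤length : ∀ {x y z} {xs : List A} → x ∈ xs → y ∈ xs → z ∈ xs →
             x ≢ y → y ≢ z → x ≢ z → 3 ≤ length xs
  3≤length {x} {y} {z} {xs} x∈xs y∈xs z∈xs x≢y y≢z x≢z = begin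
    3                                ≤⟨ s≤s (s≤s (∈⇒0<length z∈xs″)) ⟩
    suc (suc (length (xs′ ─ y∈xs′))) ≡⟨ cong suc (length-─ y∈xs′) ⟨
    suc (length xs′)                 ≡⟨ length-─ x∈xs ⟨
    length xs                        ∎
    where
    open ≤-Reasoning
    xs′ : List A
    xs′ = xs ─ x∈xs
    y∈xs′ : y ∈ xs′
    y∈xs′ = ∈-─ x∈xs y∈xs (x≢y ∘ sym)
    z∈xs″ : z ∈ (xs′ ─ y∈xs′)
    z∈xs″ = ∈-─ y∈xs′ (∈-─ x∈xs z∈xs (x≢z ∘ sym)) (y≢z ∘ sym)

record ThreePrimeDivisors (m : ℕ) : Set where
  constructor divisors
  field
    {p q r}  : ℕ
    primes   : Prime p × Prime q × Prime r
    dividing : p ∣ m × q ∣ m × r ∣ m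
    distinct : p ≢ q × q ≢ r × p ≢ r

ThreePrimeDivisors-∣ : ∀ {m n} → m ∣ n → ThreePrimeDivisors m → ThreePrimeDivisors n
ThreePrimeDivisors-∣ m∣n (divisors ps (p∣m , q∣m , r∣m) ds) =
  divisors ps (∣-trans p∣m m∣n , ∣-trans q∣m m∣n , ∣-trans r∣m m∣n) ds

primeDivisor∈primeDivisors : ∀ {m p} .{{_ : NonZero m}} → Prime p → p ∣ m → p ∈ primeDivisors m
primeDivisor∈primeDivisors {m} p-prime p∣m =
  ∈-filter⁺ (λ p → prime? p ×-dec (p ∣? m)) (∈-upTo⁺ (s≤s (∣⇒≤ p∣m))) (p-prime , p∣m)

3≤ω : ∀ {m} .{{_ : NonZero m}} → ThreePrimeDivisors m → 3 ≤ ω m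
3≤ω (divisors (pp , pq , pr) (p∣m , q∣m , r∣m) (p≢q , q≢r , p≢r)) =
  3≤length (primeDivisor∈primeDivisors pp p∣m) (primeDivisor∈primeDivisors pq q∣m)
           (primeDivisor∈primeDivisors pr r∣m) p≢q q≢r p≢r

prime-factor : ∀ {n} → 1 < n → ∃ λ q → Prime q × q ∣ n
prime-factor {n@(suc _)} 1<n with factorise n
... | record { factors = [] ; isFactorisation = n≡1 } = contradiction n≡1 (>⇒≢ 1<n)
... | record { factors = q ∷ qs ; isFactorisation = n≡q*Πqs ; factorsPrime = q-prime ∷ _ } =
  q , q-prime , divides (product qs) (trans n≡q*Πqs (*-comm q (product qs)))

prime⇒1< : ∀ {p} → Prime p → 1 < p
prime⇒1< {p} p-prime = nonTrivial⇒n>1 p {{prime⇒nonTrivial p-prime}}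

prime∣prime⇒≡ : ∀ {p q} → Prime p → Prime q → p ∣ q → p ≡ q
prime∣prime⇒≡ p-prime q-prime p∣q with prime⇒irreducible q-prime p∣q
... | inj₁ p≡1 = contradiction p≡1 (>⇒≢ (prime⇒1< p-prime))
... | inj₂ p≡q = p≡q

≢-primes-coprime : ∀ {p q} → Prime p → Prime q → p ≢ q → Coprime p q
≢-primes-coprime p-prime q-prime p≢q (d∣p , d∣q) with prime⇒irreducible p-prime d∣p
... | inj₁ d≡1 = d≡1
... | inj₂ refl = contradiction (prime∣prime⇒≡ p-prime q-prime d∣q) p≢q

∤m∧∣n⇒∤m+n : ∀ {d} m {n} → d ∤ m → d ∣ n → d ∤ m + n
∤m∧∣n⇒∤m+n {d} m {n} d∤m d∣n d∣m+n = d∤m (∣m+n∣m⇒∣n (subst (d ∣_) (+-comm m n) d∣m+n) d∣n)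

∣∧∤⇒≢ : ∀ {a b m} → a ∣ m → b ∤ m → a ≢ b
∣∧∤⇒≢ a∣m b∤m refl = b∤m a∣m

odd⇒2m+1 : ∀ {n} → 2 ∤ n → ∃ λ m → n ≡ suc (2 * m)
odd⇒2m+1 {0}           2∤0   = contradiction (2 ∣0) 2∤0
odd⇒2m+1 {1}           _     = 0 , refl
odd⇒2m+1 {suc (suc n)} 2∤2+n with odd⇒2m+1 {n} (2∤2+n ∘ ∣m∣n⇒∣m+n ∣-refl)
... | m , refl = suc m , cong suc (sym (*-suc 2 m))

coprime-to-6 : ∀ {n} → 2 ∤ n → 3 ∤ n → ∃ λ j → n ≡ 6 * j + 1 ⊎ n ≡ 6 * j + 5
coprime-to-6 {0} 2∤n _ = contradiction (2 ∣0) 2∤n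
coprime-to-6 {1} _ _ = 0 , inj₁ refl
coprime-to-6 {2} 2∤n _ = contradiction ∣-refl 2∤n
coprime-to-6 {3} _ 3∤n = contradiction ∣-refl 3∤n
coprime-to-6 {4} 2∤n _ = contradiction (divides 2 refl) 2∤n
coprime-to-6 {5} _ _ = 0 , inj₂ refl
coprime-to-6 {suc (suc (suc (suc (suc (suc n)))))} 2∤6+n 3∤6+n
  with coprime-to-6 {n} (2∤6+n ∘ ∣m∣n⇒∣m+n (divides 3 refl)) (3∤6+n ∘ ∣m∣n⇒∣m+n (divides 2 refl))
... | j , inj₁ refl = suc j , inj₁ (cong (_+ 1) (sym (*-suc 6 j)))
... | j , inj₂ refl = suc j , inj₂ (cong (_+ 5) (sym (*-suc 6 j)))

prime[3] : Prime 3
prime[3] = from-yes (prime? 3)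

n<2^n : ∀ n → n < 2 ^ n
n<2^n zero    = z<s
n<2^n (suc n) = subst (suc n <_) (cong (2 ^ n +_) (sym (+-identityʳ (2 ^ n)))) (+-mono-≤ (m^n>0 2 n) (n<2^n n))

-- Geometric sums

Σ< : (ℕ → ℕ) → ℕ → ℕ
Σ< f zero    = 0
Σ< f (suc k) = Σ< f k + f k

Σ<-const-1 : ∀ k → Σ< (λ _ → 1) k ≡ k
Σ<-const-1 zero    = refl
Σ<-const-1 (suc k) = trans (cong (_+ 1) (Σ<-const-1 k)) (+-comm k 1)

Σ<-affine : ∀ {f g h} y → (∀ i → f i ≡ g i + y * h i) → ∀ k → Σ< f k ≡ Σ< g k + y * Σ< h k
Σ<-affine y eq zero    = sym (*-zeroʳ y)
Σ<-affine {f} {g} {h} y eq (suc k) = begin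
  Σ< f k + f k                                 ≡⟨ cong₂ _+_ (Σ<-affine y eq k) (eq k) ⟩
  (Σ< g k + y * Σ< h k) + (g k + y * h k)      ≡⟨ regroup (Σ< g k) (g k) y (Σ< h k) (h k) ⟩
  (Σ< g k + g k) + y * (Σ< h k + h k)          ∎
  where
  open ≡-Reasoning
  regroup : ∀ a b y c d → (a + y * c) + (b + y * d) ≡ (a + b) + y * (c + d)
  regroup = solve-∀

2*Σ<-id : ∀ k → 2 * Σ< id (suc k) ≡ suc k * k
2*Σ<-id zero    = refl
2*Σ<-id (suc k) = begin
  2 * (Σ< id (suc k) + suc k)  ≡⟨ *-distribˡ-+ 2 (Σ< id (suc k)) (suc k) ⟩
  2 * Σ< id (suc k) + 2 * suc k ≡⟨ cong (_+ 2 * suc k) (2*Σ<-id k) ⟩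
  suc k * k + 2 * suc k        ≡⟨ gauss k ⟩
  suc (suc k) * suc k          ∎
  where
  open ≡-Reasoning
  gauss : ∀ k → suc k * k + 2 * suc k ≡ suc (suc k) * suc k
  gauss = solve-∀

Σ<-id-odd : ∀ m → Σ< id (suc (2 * m)) ≡ suc (2 * m) * m
Σ<-id-odd m = *-cancelˡ-≡ _ _ 2 (begin
  2 * Σ< id (suc (2 * m)) ≡⟨ 2*Σ<-id (2 * m) ⟩
  suc (2 * m) * (2 * m)   ≡⟨ x*[2*m]≡2*[x*m] (suc (2 * m)) m ⟩
  2 * (suc (2 * m) * m)   ∎)
  where
  open ≡-Reasoning
  x*[2*m]≡2*[x*m] : ∀ x m → x * (2 * m) ≡ 2 * (x * m)
  x*[2*m]≡2*[x*m] = solve-∀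

geom : ℕ → ℕ → ℕ
geom x = Σ< (x ^_)

suc[y]^k≡1+y*geom : ∀ y k → suc y ^ k ≡ 1 + y * geom (suc y) k
suc[y]^k≡1+y*geom y zero    = cong suc (sym (*-zeroʳ y))
suc[y]^k≡1+y*geom y (suc k) = begin
  suc y * suc y ^ k                       ≡⟨ cong (suc y *_) (suc[y]^k≡1+y*geom y k) ⟩
  suc y * (1 + y * g)                     ≡⟨ expand y g ⟩
  1 + y * (g + (1 + y * g))               ≡⟨ cong (λ t → 1 + y * (g + t)) (suc[y]^k≡1+y*geom y k) ⟨
  1 + y * (g + suc y ^ k)                 ∎
  where
  open ≡-Reasoning
  g : ℕ
  g = geom (suc y) k
  expand : ∀ y g → suc y * (1 + y * g) ≡ 1 + y * (g + (1 + y * g))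
  expand = solve-∀

geom-expansion : ∀ y k → geom (suc y) k ≡ k + y * Σ< (geom (suc y)) k
geom-expansion y k = trans (Σ<-affine y (suc[y]^k≡1+y*geom y) k) (cong (_+ y * Σ< (geom (suc y)) k) (Σ<-const-1 k))

geom-expansion₂ : ∀ y k → geom (suc y) k ≡ k + y * (Σ< id k + y * Σ< (Σ< (geom (suc y))) k)
geom-expansion₂ y k =
  trans (geom-expansion y k) (cong (λ t → k + y * t) (Σ<-affine {g = id} y (geom-expansion y) k))

∣y∧∣geom⇒∣k : ∀ {q y k} → q ∣ y → q ∣ geom (suc y) k → q ∣ k
∣y∧∣geom⇒∣k {q} {y} {k} q∣y q∣geom =
  ∣m+n∣m⇒∣n (subst (q ∣_) (trans (geom-expansion y k) (+-comm k _)) q∣geom) (∣-trans q∣y (m∣m*n _))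

∣y∧∣k⇒∣geom : ∀ {q y k} → q ∣ y → q ∣ k → q ∣ geom (suc y) k
∣y∧∣k⇒∣geom {q} {y} {k} q∣y q∣k =
  subst (q ∣_) (sym (geom-expansion y k)) (∣m∣n⇒∣m+n q∣k (∣-trans q∣y (m∣m*n _)))

k<geom : ∀ y {k} .{{_ : NonZero y}} → 1 < k → k < geom (suc y) k
k<geom y {1} (s<s ())
k<geom y {k@(suc (suc j))} _ = begin-strict
  k                      <⟨ m<m+n k (*-mono-≤ (>-nonZero⁻¹ y) 0<T) ⟩
  k + y * T              ≡⟨ geom-expansion y k ⟨
  geom (suc y) k         ∎
  where
  open ≤-Reasoning
  G : ℕ → ℕ
  G = geom (suc y)
  T : ℕ
  T = Σ< G k
  0<T : 0 < T
  0<T = ≤-trans (m^n>0 (suc y) j) (≤-trans (m≤n+m _ (G j)) (m≤n+m (G (suc j)) (Σ< G (suc j))))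

-- With y = a p and p = 2m + 1, both y · Σ< id p = a p · p m and y² · U are multiples of p², so
-- geom (1 + y) p ≡ p (mod p²).
p²∤geom : ∀ {p y} → 1 < p → 2 ∤ p → p ∣ y → p * p ∤ geom (suc y) p
p²∤geom {p} 1<p 2∤p p∣y p²∣geom with odd⇒2m+1 2∤p | p∣y
... | m , refl | divides a refl = <⇒≱ (m<m*n p p 1<p) (∣⇒≤ p²∣p)
  where
  U : ℕ
  U = Σ< (Σ< (geom (suc (a * p)))) p
  rearrange : ∀ p a m u → p + a * p * (p * m + a * p * u) ≡ p * p * (a * (m + a * u)) + p
  rearrange = solve-∀
  geom≡ : geom (suc (a * p)) p ≡ p * p * (a * (m + a * U)) + p
  geom≡ = trans (geom-expansion₂ (a * p) p)
                (trans (cong (λ t → p + a * p * (t + a * p * U)) (Σ<-id-odd m)) (rearrange p a m U))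
  p²∣p : p * p ∣ p
  p²∣p = ∣m+n∣m⇒∣n (subst (p * p ∣_) geom≡ p²∣geom) (m∣m*n _)

prime∣y∧∣geom⇒≡ : ∀ {p q y} → Prime p → Prime q → q ∣ y → q ∣ geom (suc y) p → q ≡ p
prime∣y∧∣geom⇒≡ p-prime q-prime q∣y q∣geom = prime∣prime⇒≡ q-prime p-prime (∣y∧∣geom⇒∣k q∣y q∣geom)

primitive-divisor-of-coprime : ∀ {p} y .{{_ : NonZero y}} → Prime p → p ∤ y →
                               ∃ λ q → Prime q × q ∣ geom (suc y) p × q ∤ y
primitive-divisor-of-coprime {p} y p-prime p∤y
  with prime-factor (<-trans (prime⇒1< p-prime) (k<geom y (prime⇒1< p-prime)))
... | q , q-prime , q∣geom =
  q , q-prime , q∣geom , λ q∣y → p∤y (subst (_∣ y) (prime∣y∧∣geom⇒≡ p-prime q-prime q∣y q∣geom) q∣y)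

primitive-divisor-of-multiple : ∀ {p} y .{{_ : NonZero y}} → Prime p → 2 ∤ p → p ∣ y →
                                ∃ λ q → Prime q × q ∣ geom (suc y) p × q ∤ y
primitive-divisor-of-multiple {p} y p-prime 2∤p p∣y with ∣y∧∣k⇒∣geom {k = p} p∣y ∣-refl
... | divides a geom≡a*p with prime-factor 1<a
  where
  1<a : 1 < a
  1<a = *-cancelʳ-< p 1 a (subst₂ _<_ (sym (*-identityˡ p)) geom≡a*p (k<geom y (prime⇒1< p-prime)))
... | q , q-prime , q∣a = q , q-prime , q∣geom , q∤y
  where
  q∣geom : q ∣ geom (suc y) p
  q∣geom = subst (q ∣_) (sym geom≡a*p) (∣-trans q∣a (m∣m*n p))
  q∤y : q ∤ y
  q∤y q∣y with prime∣y∧∣geom⇒≡ p-prime q-prime q∣y q∣geom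
  ... | refl = p²∤geom (prime⇒1< p-prime) 2∤p p∣y (subst (p * p ∣_) (sym geom≡a*p) (*-monoˡ-∣ p q∣a))

primitive-divisor : ∀ {p} y .{{_ : NonZero y}} → Prime p → 2 ∤ p →
                    ∃ λ q → Prime q × q ∣ geom (suc y) p × q ∤ y
primitive-divisor {p} y p-prime 2∤p with p ∣? y
... | no p∤y  = primitive-divisor-of-coprime y p-prime p∤y
... | yes p∣y = primitive-divisor-of-multiple y p-prime 2∤p p∣y

-- Mersenne numbers

2^n≡1+M : ∀ n → 2 ^ n ≡ suc (M n)
2^n≡1+M n = sym (m+[n∸m]≡n (m^n>0 2 n))

M-nonZero : ∀ n .{{_ : NonZero n}} → NonZero (M n)
M-nonZero n = >-nonZero (≤-pred (subst (2 ≤_) (2^n≡1+M n) (^-monoʳ-≤ 2 (>-nonZero⁻¹ n))))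

1<M : ∀ {n} → 1 < n → 1 < M n
1<M {n} 1<n = ≤-trans (n≤1+n 2) (≤-pred (subst (4 ≤_) (2^n≡1+M n) (^-monoʳ-≤ 2 1<n)))

M-+ : ∀ a b → M (a + b) ≡ M a + 2 ^ a * M b
M-+ a b = suc-injective (begin
  suc (M (a + b))             ≡⟨ 2^n≡1+M (a + b) ⟨
  2 ^ (a + b)                 ≡⟨ ^-distribˡ-+-* 2 a b ⟩
  2 ^ a * 2 ^ b               ≡⟨ cong (2 ^ a *_) (2^n≡1+M b) ⟩
  2 ^ a * suc (M b)           ≡⟨ *-suc (2 ^ a) (M b) ⟩
  2 ^ a + 2 ^ a * M b         ≡⟨ cong (_+ 2 ^ a * M b) (2^n≡1+M a) ⟩
  suc (M a + 2 ^ a * M b)     ∎)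
  where open ≡-Reasoning

M-* : ∀ a b → M (a * b) ≡ M a * geom (suc (M a)) b
M-* a b = begin
  2 ^ (a * b) ∸ 1                 ≡⟨ cong (_∸ 1) (^-*-assoc 2 a b) ⟨
  (2 ^ a) ^ b ∸ 1                 ≡⟨ cong (λ x → x ^ b ∸ 1) (2^n≡1+M a) ⟩
  suc (M a) ^ b ∸ 1               ≡⟨ cong (_∸ 1) (suc[y]^k≡1+y*geom (M a) b) ⟩
  M a * geom (suc (M a)) b        ∎
  where open ≡-Reasoning

M[a]∣M[a*b] : ∀ a b → M a ∣ M (a * b)
M[a]∣M[a*b] a b = divides (geom (suc (M a)) b) (trans (M-* a b) (*-comm (M a) _))

geom∣M[a*b] : ∀ a b → geom (suc (M a)) b ∣ M (a * b)
geom∣M[a*b] a b = divides (M a) (M-* a b)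

M-∣ : ∀ {a b} → a ∣ b → M a ∣ M b
M-∣ {a} (divides q refl) = subst (λ n → M a ∣ M n) (*-comm a q) (M[a]∣M[a*b] a q)

1+yb≡xa⇒M-coprime : ∀ {a b} x y → 1 + y * b ≡ x * a → Coprime (M a) (M b)
1+yb≡xa⇒M-coprime {a} {b} x y 1+yb≡xa {d} (d∣Ma , d∣Mb) =
  ∣1⇒≡1 (∣m+n∣m⇒∣n (subst (d ∣_) M[1+yb]≡ d∣M[1+yb]) (∣-trans d∣Mb (∣-trans (M-∣ (n∣m*n y)) (n∣m*n 2))))
  where
  M[1+yb]≡ : M (1 + y * b) ≡ 2 * M (y * b) + 1
  M[1+yb]≡ = trans (M-+ 1 (y * b)) (+-comm 1 _)
  d∣M[1+yb] : d ∣ M (1 + y * b)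
  d∣M[1+yb] = subst (λ n → d ∣ M n) (sym 1+yb≡xa) (∣-trans d∣Ma (M-∣ (n∣m*n x)))

M-coprime : ∀ {a b} → Coprime a b → Coprime (M a) (M b)
M-coprime a⊥b with coprime-Bézout a⊥b
... | Bézout.+- x y 1+yb≡xa = 1+yb≡xa⇒M-coprime x y 1+yb≡xa
... | Bézout.-+ x y 1+xa≡yb = Coprimality.sym (1+yb≡xa⇒M-coprime y x 1+xa≡yb)

M-odd : ∀ n → 2 ∤ M (suc n)
M-odd n = ∤m∧∣n⇒∤m+n 1 (from-no (2 ∣? 1)) (m∣m*n (M n)) ∘ subst (2 ∣_) (M-+ 1 n)

2+M≡2^n+1 : ∀ n → 2 + M n ≡ 2 ^ n + 1
2+M≡2^n+1 n = trans (cong suc (sym (2^n≡1+M n))) (+-comm 1 (2 ^ n))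

M[2n]≡ : ∀ n → M (2 * n) ≡ M n * (2 + M n)
M[2n]≡ n = trans (cong M (*-comm 2 n)) (trans (M-* n 2) (cong (λ t → M n * (2 + t)) (*-identityʳ (M n))))

M-cofactor : ∀ {a b} .{{_ : NonZero b}} → Coprime a b →
             ∃ λ R → geom (suc (M a)) b ≡ R * M b × geom (suc (M b)) a ≡ M a * R
M-cofactor {a} {b} a⊥b with coprime-divisor (Coprimality.sym (M-coprime a⊥b)) (subst (M b ∣_) (M-* a b) (M-∣ (n∣m*n a)))
... | divides R geom≡R*Mb = R , geom≡R*Mb , *-cancelˡ-≡ _ _ (M b) {{M-nonZero b}} (begin
  M b * geom (suc (M b)) a   ≡⟨ M-* b a ⟨
  M (b * a)                  ≡⟨ cong M (*-comm b a) ⟩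
  M (a * b)                  ≡⟨ M-* a b ⟩
  M a * geom (suc (M a)) b   ≡⟨ cong (M a *_) geom≡R*Mb ⟩
  M a * (R * M b)            ≡⟨ rotate (M a) R (M b) ⟩
  M b * (M a * R)            ∎)
  where
  open ≡-Reasoning
  rotate : ∀ x r z → x * (r * z) ≡ z * (x * r)
  rotate = solve-∀

-- p³ ∣ n

threePrimeDivisors-M[p*p*p] : ∀ {p} → Prime p → 2 ∤ p → ThreePrimeDivisors (M (p * p * p))
threePrimeDivisors-M[p*p*p] {p} p-prime 2∤p
  with prime-factor (1<M (prime⇒1< p-prime))
     | primitive-divisor (M p) {{M-nonZero p}} p-prime 2∤p
     | primitive-divisor (M (p * p)) {{M-nonZero (p * p) {{m*n≢0 p p}}}} p-prime 2∤p
  where instance _ = prime⇒nonZero p-prime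
... | q₁ , q₁-prime , q₁∣M[p] | q₂ , q₂-prime , q₂∣geom , q₂∤M[p] | q₃ , q₃-prime , q₃∣geom′ , q₃∤M[p²] =
  divisors (q₁-prime , q₂-prime , q₃-prime)
           (∣-trans q₁∣M[p²] M[p²]∣M[p³] , ∣-trans q₂∣M[p²] M[p²]∣M[p³] , ∣-trans q₃∣geom′ (geom∣M[a*b] (p * p) p))
           (∣∧∤⇒≢ q₁∣M[p] q₂∤M[p] , ∣∧∤⇒≢ q₂∣M[p²] q₃∤M[p²] , ∣∧∤⇒≢ q₁∣M[p²] q₃∤M[p²])
  where
  M[p²]∣M[p³] : M (p * p) ∣ M (p * p * p)
  M[p²]∣M[p³] = M[a]∣M[a*b] (p * p) p
  q₁∣M[p²] : q₁ ∣ M (p * p)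
  q₁∣M[p²] = ∣-trans q₁∣M[p] (M[a]∣M[a*b] p p)
  q₂∣M[p²] : q₂ ∣ M (p * p)
  q₂∣M[p²] = ∣-trans q₂∣geom (geom∣M[a*b] p p)

threePrimeDivisors-M[p³] : ∀ {p} → Prime p → 2 ∤ p → ThreePrimeDivisors (M (p ^ 3))
threePrimeDivisors-M[p³] {p} p-prime 2∤p =
  subst (λ n → ThreePrimeDivisors (M n)) (sym p^3≡p*p*p) (threePrimeDivisors-M[p*p*p] p-prime 2∤p)
  where
  p^3≡p*p*p : p ^ 3 ≡ p * p * p
  p^3≡p*p*p = trans (cong (λ t → p * (p * t)) (*-identityʳ p)) (sym (*-assoc p p p))

-- 2p ∣ n

3∣2^[2m+1]+1 : ∀ m → 3 ∣ 2 ^ suc (2 * m) + 1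
3∣2^[2m+1]+1 m = divides (1 + 2 * g) (begin
  2 * 2 ^ (2 * m) + 1    ≡⟨ cong (λ t → 2 * t + 1) (^-*-assoc 2 2 m) ⟨
  2 * 4 ^ m + 1          ≡⟨ cong (λ t → 2 * t + 1) (suc[y]^k≡1+y*geom 3 m) ⟩
  2 * (1 + 3 * g) + 1    ≡⟨ regroup g ⟩
  (1 + 2 * g) * 3        ∎)
  where
  open ≡-Reasoning
  g : ℕ
  g = geom 4 m
  regroup : ∀ g → 2 * (1 + 3 * g) + 1 ≡ (1 + 2 * g) * 3
  regroup = solve-∀

2^[6j+e]+1≡ : ∀ j e → 2 ^ (6 * j + e) + 1 ≡ 2 ^ e + 1 + 9 * (7 * 2 ^ e * geom 64 j)
2^[6j+e]+1≡ j e = begin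
  2 ^ (6 * j + e) + 1           ≡⟨ cong (_+ 1) (^-distribˡ-+-* 2 (6 * j) e) ⟩
  2 ^ (6 * j) * 2 ^ e + 1       ≡⟨ cong (λ t → t * 2 ^ e + 1) (^-*-assoc 2 6 j) ⟨
  64 ^ j * 2 ^ e + 1            ≡⟨ cong (λ t → t * 2 ^ e + 1) (suc[y]^k≡1+y*geom 63 j) ⟩
  (1 + 63 * g) * 2 ^ e + 1      ≡⟨ regroup g (2 ^ e) ⟩
  2 ^ e + 1 + 9 * (7 * 2 ^ e * g) ∎
  where
  open ≡-Reasoning
  g : ℕ
  g = geom 64 j
  regroup : ∀ g x → (1 + 63 * g) * x + 1 ≡ x + 1 + 9 * (7 * x * g)
  regroup = solve-∀

9∤2^n+1 : ∀ {n} → 2 ∤ n → 3 ∤ n → 9 ∤ 2 ^ n + 1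
9∤2^n+1 2∤n 3∤n with coprime-to-6 2∤n 3∤n
... | j , inj₁ refl =
  ∤m∧∣n⇒∤m+n (2 ^ 1 + 1) (from-no (9 ∣? 3))  (m∣m*n (7 * 2 ^ 1 * geom 64 j)) ∘ subst (9 ∣_) (2^[6j+e]+1≡ j 1)
... | j , inj₂ refl =
  ∤m∧∣n⇒∤m+n (2 ^ 5 + 1) (from-no (9 ∣? 33)) (m∣m*n (7 * 2 ^ 5 * geom 64 j)) ∘ subst (9 ∣_) (2^[6j+e]+1≡ j 5)

threePrimeDivisors-y*[2+y] : ∀ {y} → 1 < y → 2 ∤ y → 3 ∣ 2 + y → 9 ∤ 2 + y →
                             ThreePrimeDivisors (y * (2 + y))
threePrimeDivisors-y*[2+y] {y} 1<y 2∤y 3∣2+y@(divides c 2+y≡c*3) 9∤2+y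
  with prime-factor 1<y | prime-factor (*-cancelʳ-< 3 1 c (subst (3 <_) 2+y≡c*3 (+-monoʳ-< 2 1<y)))
... | q₁ , q₁-prime , q₁∣y | q₃ , q₃-prime , q₃∣c =
  divisors (q₁-prime , prime[3] , q₃-prime)
           (∣-trans q₁∣y (m∣m*n (2 + y)) , ∣-trans 3∣2+y (n∣m*n y) , ∣-trans q₃∣2+y (n∣m*n y))
           (∣∧∤⇒≢ q₁∣y 3∤y , ∣∧∤⇒≢ q₃∣c 3∤c ∘ sym , q₁≢q₃)
  where
  c∣2+y : c ∣ 2 + y
  c∣2+y = divides 3 (trans 2+y≡c*3 (*-comm c 3))
  q₃∣2+y : q₃ ∣ 2 + y
  q₃∣2+y = ∣-trans q₃∣c c∣2+y
  3∤y : 3 ∤ y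
  3∤y 3∣y = from-no (3 ∣? 2) (∣m+n∣m⇒∣n (subst (3 ∣_) (+-comm 2 y) 3∣2+y) 3∣y)
  3∤c : 3 ∤ c
  3∤c 3∣c = 9∤2+y (subst (9 ∣_) (sym 2+y≡c*3) (*-monoˡ-∣ 3 3∣c))
  q₁≢q₃ : q₁ ≢ q₃
  q₁≢q₃ refl = 2∤y (subst (_∣ y) q₁≡2 q₁∣y)
    where
    q₁≡2 : q₁ ≡ 2
    q₁≡2 = prime∣prime⇒≡ q₁-prime prime[2] (∣m+n∣m⇒∣n (subst (q₁ ∣_) (+-comm 2 y) q₃∣2+y) q₁∣y)

threePrimeDivisors-M[2p] : ∀ {p} → Prime p → 2 ∤ p → p ≢ 3 → ThreePrimeDivisors (M (2 * p))
threePrimeDivisors-M[2p] {p} p-prime 2∤p p≢3 with odd⇒2m+1 2∤p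
... | m , refl = subst ThreePrimeDivisors (sym (M[2n]≡ p))
  (threePrimeDivisors-y*[2+y] (1<M (prime⇒1< p-prime)) (M-odd (2 * m))
    (subst (3 ∣_) (sym (2+M≡2^n+1 p)) (3∣2^[2m+1]+1 m))
    (9∤2^n+1 2∤p 3∤p ∘ subst (9 ∣_) (2+M≡2^n+1 p)))
  where
  3∤p : 3 ∤ p
  3∤p 3∣p = p≢3 (sym (prime∣prime⇒≡ prime[3] p-prime 3∣p))

-- p₁ p₂ ∣ n

8j+17<2^[4j+7] : ∀ j → 8 * j + 17 < 2 ^ (4 * j + 7)
8j+17<2^[4j+7] j = begin-strict
  8 * j + 17           ≤⟨ m≤m+n (8 * j + 17) (56 * j + 31) ⟩
  8 * j + 17 + (56 * j + 31) ≡⟨ regroup j ⟩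
  16 * (4 * j + 3)     <⟨ *-monoʳ-< 16 (n<2^n (4 * j + 3)) ⟩
  16 * 2 ^ (4 * j + 3) ≡⟨ ^-distribˡ-+-* 2 4 (4 * j + 3) ⟨
  2 ^ (4 + (4 * j + 3)) ≡⟨ cong (2 ^_) (exponent j) ⟩
  2 ^ (4 * j + 7)      ∎
  where
  open ≤-Reasoning
  regroup : ∀ j → 8 * j + 17 + (56 * j + 31) ≡ 16 * (4 * j + 3)
  regroup = solve-∀
  exponent : ∀ j → 4 + (4 * j + 3) ≡ 4 * j + 7
  exponent = solve-∀

2≤a*b : ∀ {a b} → 0 < a → 0 < b → a ≢ b → 2 ≤ a * b
2≤a*b {1}           {1}     _ _ 1≢1 = contradiction refl 1≢1
2≤a*b {1}           {suc (suc b)} _ _ _ = s≤s (s≤s z≤n)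
2≤a*b {suc (suc a)} {suc b} _ _ _ = ≤-trans (s≤s (s≤s z≤n)) (m≤m*n (suc (suc a)) (suc b))

-- With p = 2a + 1, q = 2b + 1 and a b = 2 + j: p (q − 1) = q + (4j + 7) and p q ≤ 8j + 17.
[2a+1][2b+1]M[2b+1]<geom : ∀ {a b} → 0 < a → 0 < b → a ≢ b →
  suc (2 * a) * suc (2 * b) * M (suc (2 * b)) < geom (suc (M (suc (2 * a)))) (suc (2 * b))
[2a+1][2b+1]M[2b+1]<geom {a} {b} 0<a 0<b a≢b with m≤n⇒∃[o]m+o≡n (2≤a*b 0<a 0<b a≢b)
... | j , 2+j≡ab = begin-strict
  p * q * M q                 ≤⟨ *-monoʳ-≤ (p * q) (n≤1+n (M q)) ⟩
  p * q * suc (M q)           ≡⟨ cong (p * q *_) (2^n≡1+M q) ⟨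
  p * q * 2 ^ q               <⟨ *-monoˡ-< (2 ^ q) {{m^n≢0 2 q}} (≤-<-trans pq≤8j+17 (8j+17<2^[4j+7] j)) ⟩
  2 ^ (4 * j + 7) * 2 ^ q     ≡⟨ ^-distribˡ-+-* 2 (4 * j + 7) q ⟨
  2 ^ (4 * j + 7 + q)         ≡⟨ cong (2 ^_) exponent ⟨
  2 ^ (p * (2 * b))           ≡⟨ ^-*-assoc 2 p (2 * b) ⟨
  (2 ^ p) ^ (2 * b)           ≡⟨ cong (_^ (2 * b)) (2^n≡1+M p) ⟩
  suc (M p) ^ (2 * b)         ≤⟨ m≤n+m _ (geom (suc (M p)) (2 * b)) ⟩
  geom (suc (M p)) q          ∎
  where
  open ≤-Reasoning
  p q : ℕ
  p = suc (2 * a)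
  q = suc (2 * b)
  expand-pq : ∀ a b → suc (2 * a) * suc (2 * b) ≡ 4 * (a * b) + 2 * a + 2 * b + 1
  expand-pq = solve-∀
  expand-j : ∀ j → 4 * (2 + j) + 2 * (2 + j) + 2 * (2 + j) + 1 ≡ 8 * j + 17
  expand-j = solve-∀
  pq≤8j+17 : p * q ≤ 8 * j + 17
  pq≤8j+17 = begin
    p * q                                    ≡⟨ expand-pq a b ⟩
    4 * (a * b) + 2 * a + 2 * b + 1          ≤⟨ +-monoˡ-≤ 1 (+-mono-≤ (+-monoʳ-≤ (4 * (a * b))
                                                  (*-monoʳ-≤ 2 (m≤m*n a b {{>-nonZero 0<b}})))
                                                  (*-monoʳ-≤ 2 (m≤n*m b a {{>-nonZero 0<a}}))) ⟩
    4 * (a * b) + 2 * (a * b) + 2 * (a * b) + 1 ≡⟨ cong (λ u → 4 * u + 2 * u + 2 * u + 1) 2+j≡ab ⟨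
    4 * (2 + j) + 2 * (2 + j) + 2 * (2 + j) + 1 ≡⟨ expand-j j ⟩
    8 * j + 17                               ∎
  expand-p2b : ∀ a b → suc (2 * a) * (2 * b) ≡ 4 * (a * b) + 2 * b
  expand-p2b = solve-∀
  regroup : ∀ j b → 4 * (2 + j) + 2 * b ≡ 4 * j + 7 + suc (2 * b)
  regroup = solve-∀
  exponent : p * (2 * b) ≡ 4 * j + 7 + q
  exponent = trans (expand-p2b a b) (trans (cong (λ u → 4 * u + 2 * b) (sym 2+j≡ab)) (regroup j b))

p*q*M[q]<geom : ∀ {p q} → Prime p → Prime q → 2 ∤ p → 2 ∤ q → p ≢ q → p * q * M q < geom (suc (M p)) q
p*q*M[q]<geom p-prime q-prime 2∤p 2∤q p≢q with odd⇒2m+1 2∤p | odd⇒2m+1 2∤q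
... | zero    , refl | _           = contradiction p-prime ¬prime[1]
... | _       , refl | zero , refl = contradiction q-prime ¬prime[1]
... | suc a , refl | suc b , refl = [2a+1][2b+1]M[2b+1]<geom z<s z<s (p≢q ∘ cong (λ m → suc (2 * m)))

remove-simple-factor : ∀ {p n} → Prime p → p * p ∤ n → ∃ λ n′ → n′ ∣ n × n ≤ p * n′ × p ∤ n′
remove-simple-factor {p} {n} p-prime p²∤n with p ∣? n
... | no p∤n = n , ∣-refl , m≤n*m n p {{prime⇒nonZero p-prime}} , p∤n
... | yes (divides k refl) = k , m∣m*n p , ≤-reflexive (*-comm k p) , p²∤n ∘ *-monoˡ-∣ p

fresh-or-simple : ∀ {p y y′ n} → (p ∣ n → p ∤ y) → (p ∣ y′ → p * p ∤ n) →
                  (p ∣ n × p ∤ y × p ∤ y′) ⊎ p * p ∤ n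
fresh-or-simple {p} {y} {y′} {n} p∣n⇒p∤y p∣y′⇒p²∤n with p ∣? y′ | p ∣? n
... | yes p∣y′ | _       = inj₂ (p∣y′⇒p²∤n p∣y′)
... | no p∤y′  | yes p∣n = inj₁ (p∣n , p∣n⇒p∤y p∣n , p∤y′)
... | no _     | no p∤n  = inj₂ (p∤n ∘ ∣-trans (m∣m*n p))

-- A prime dividing R and y₁ divides geom (1 + y₁) p₂ ≡ p₂ (mod y₁), so it is p₂, and p₂² ∤ R
-- when p₂ ∣ y₁; symmetrically for y₂ and p₁.  Removing p₁ and p₂ from R leaves a factor > 1.
module _ {p₁ p₂ y₁ y₂ R : ℕ} (p₁-prime : Prime p₁) (p₂-prime : Prime p₂)
         (2∤p₁ : 2 ∤ p₁) (2∤p₂ : 2 ∤ p₂) (p₁≢p₂ : p₁ ≢ p₂)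
         (R∣G₁ : R ∣ geom (suc y₁) p₂) (R∣G₂ : R ∣ geom (suc y₂) p₁) (p₁p₂<R : p₁ * p₂ < R) where

  private
    ∣R∧∣y₁⇒≡p₂ : ∀ {q} → Prime q → q ∣ R → q ∣ y₁ → q ≡ p₂
    ∣R∧∣y₁⇒≡p₂ q-prime q∣R q∣y₁ = prime∣y∧∣geom⇒≡ p₂-prime q-prime q∣y₁ (∣-trans q∣R R∣G₁)

    ∣R∧∣y₂⇒≡p₁ : ∀ {q} → Prime q → q ∣ R → q ∣ y₂ → q ≡ p₁
    ∣R∧∣y₂⇒≡p₁ q-prime q∣R q∣y₂ = prime∣y∧∣geom⇒≡ p₁-prime q-prime q∣y₂ (∣-trans q∣R R∣G₂)

    fresh-divisor-of-cofactor : p₁ * p₁ ∤ R → p₂ * p₂ ∤ R → ∃ λ q → Prime q × q ∣ R × q ∤ y₁ × q ∤ y₂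
    fresh-divisor-of-cofactor p₁²∤R p₂²∤R with remove-simple-factor p₁-prime p₁²∤R
    ... | R₁ , R₁∣R , R≤p₁R₁ , p₁∤R₁ with remove-simple-factor p₂-prime (p₂²∤R ∘ λ d → ∣-trans d R₁∣R)
    ... | R₂ , R₂∣R₁ , R₁≤p₂R₂ , p₂∤R₂ with 1 <? R₂
    ... | no R₂≤1 = contradiction R≤p₁p₂ (<⇒≱ p₁p₂<R)
      where
      R≤p₁p₂ : R ≤ p₁ * p₂
      R≤p₁p₂ = begin
        R              ≤⟨ R≤p₁R₁ ⟩
        p₁ * R₁        ≤⟨ *-monoʳ-≤ p₁ R₁≤p₂R₂ ⟩
        p₁ * (p₂ * R₂) ≤⟨ *-monoʳ-≤ p₁ (*-monoʳ-≤ p₂ (≮⇒≥ R₂≤1)) ⟩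
        p₁ * (p₂ * 1)  ≡⟨ cong (p₁ *_) (*-identityʳ p₂) ⟩
        p₁ * p₂        ∎
        where open ≤-Reasoning
    ... | yes 1<R₂ with prime-factor 1<R₂
    ... | q , q-prime , q∣R₂ =
      q , q-prime , q∣R , q≢p₂ ∘ ∣R∧∣y₁⇒≡p₂ q-prime q∣R , q≢p₁ ∘ ∣R∧∣y₂⇒≡p₁ q-prime q∣R
      where
      q∣R : q ∣ R
      q∣R = ∣-trans q∣R₂ (∣-trans R₂∣R₁ R₁∣R)
      q≢p₁ : q ≢ p₁
      q≢p₁ refl = p₁∤R₁ (∣-trans q∣R₂ R₂∣R₁)
      q≢p₂ : q ≢ p₂
      q≢p₂ refl = p₂∤R₂ q∣R₂

  fresh-prime-divisor : ∃ λ q → Prime q × q ∣ R × q ∤ y₁ × q ∤ y₂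
  fresh-prime-divisor
    with fresh-or-simple (λ p₁∣R → p₁≢p₂ ∘ ∣R∧∣y₁⇒≡p₂ p₁-prime p₁∣R)
                         (λ p₁∣y₂ → p²∤geom (prime⇒1< p₁-prime) 2∤p₁ p₁∣y₂ ∘ λ d → ∣-trans d R∣G₂)
       | fresh-or-simple (λ p₂∣R → p₁≢p₂ ∘ sym ∘ ∣R∧∣y₂⇒≡p₁ p₂-prime p₂∣R)
                         (λ p₂∣y₁ → p²∤geom (prime⇒1< p₂-prime) 2∤p₂ p₂∣y₁ ∘ λ d → ∣-trans d R∣G₁)
  ... | inj₁ (p₁∣R , p₁∤y₁ , p₁∤y₂) | _                           = p₁ , p₁-prime , p₁∣R , p₁∤y₁ , p₁∤y₂
  ... | inj₂ _                      | inj₁ (p₂∣R , p₂∤y₂ , p₂∤y₁) = p₂ , p₂-prime , p₂∣R , p₂∤y₁ , p₂∤y₂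
  ... | inj₂ p₁²∤R                  | inj₂ p₂²∤R                  = fresh-divisor-of-cofactor p₁²∤R p₂²∤R

threePrimeDivisors-of-cofactor : ∀ {p₁ p₂ R} → Prime p₁ → Prime p₂ → 2 ∤ p₁ → 2 ∤ p₂ → p₁ ≢ p₂ →
  geom (suc (M p₁)) p₂ ≡ R * M p₂ → geom (suc (M p₂)) p₁ ≡ M p₁ * R → ThreePrimeDivisors (M (p₁ * p₂))
threePrimeDivisors-of-cofactor {p₁} {p₂} {R} p₁-prime p₂-prime 2∤p₁ 2∤p₂ p₁≢p₂ G₁≡R*y₂ G₂≡y₁*R =
  combine (fresh-prime-divisor p₁-prime p₂-prime 2∤p₁ 2∤p₂ p₁≢p₂ R∣G₁ (divides (M p₁) G₂≡y₁*R) p₁p₂<R)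
          (prime-factor (1<M (prime⇒1< p₁-prime))) (prime-factor (1<M (prime⇒1< p₂-prime)))
  where
  R∣G₁ : R ∣ geom (suc (M p₁)) p₂
  R∣G₁ = divides (M p₂) (trans G₁≡R*y₂ (*-comm R (M p₂)))
  p₁p₂<R : p₁ * p₂ < R
  p₁p₂<R = *-cancelʳ-< (M p₂) (p₁ * p₂) R
             (subst (p₁ * p₂ * M p₂ <_) G₁≡R*y₂ (p*q*M[q]<geom p₁-prime p₂-prime 2∤p₁ 2∤p₂ p₁≢p₂))
  combine : (∃ λ q → Prime q × q ∣ R × q ∤ M p₁ × q ∤ M p₂) →
            (∃ λ q₁ → Prime q₁ × q₁ ∣ M p₁) → (∃ λ q₂ → Prime q₂ × q₂ ∣ M p₂) →
            ThreePrimeDivisors (M (p₁ * p₂))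
  combine (q , q-prime , q∣R , q∤y₁ , q∤y₂) (q₁ , q₁-prime , q₁∣y₁) (q₂ , q₂-prime , q₂∣y₂) =
    divisors (q₁-prime , q₂-prime , q-prime)
             ( ∣-trans q₁∣y₁ (M-∣ {p₁} (m∣m*n p₂)) , ∣-trans q₂∣y₂ (M-∣ {p₂} (n∣m*n p₁))
             , ∣-trans q∣R (∣-trans R∣G₁ (geom∣M[a*b] p₁ p₂)))
             (q₁≢q₂ , ∣∧∤⇒≢ q₂∣y₂ q∤y₂ , ∣∧∤⇒≢ q₁∣y₁ q∤y₁)
    where
    q₁≢q₂ : q₁ ≢ q₂
    q₁≢q₂ refl = contradiction (M-coprime (≢-primes-coprime p₁-prime p₂-prime p₁≢p₂) (q₁∣y₁ , q₂∣y₂))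
                               (>⇒≢ (prime⇒1< q₁-prime))

threePrimeDivisors-M[p₁p₂] : ∀ {p₁ p₂} → Prime p₁ → Prime p₂ → 2 ∤ p₁ → 2 ∤ p₂ → p₁ ≢ p₂ →
                             ThreePrimeDivisors (M (p₁ * p₂))
threePrimeDivisors-M[p₁p₂] p₁-prime p₂-prime 2∤p₁ 2∤p₂ p₁≢p₂ =
  let R , G₁≡R*y₂ , G₂≡y₁*R = M-cofactor {{prime⇒nonZero p₂-prime}} (≢-primes-coprime p₁-prime p₂-prime p₁≢p₂)
  in  threePrimeDivisors-of-cofactor p₁-prime p₂-prime 2∤p₁ 2∤p₂ p₁≢p₂ G₁≡R*y₂ G₂≡y₁*R

threePrimeDivisors-M[8] : ThreePrimeDivisors (M 8)
threePrimeDivisors-M[8] = divisors (from-yes (prime? 3) , from-yes (prime? 5) , from-yes (prime? 17))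
  (from-yes (3 ∣? M 8) , from-yes (5 ∣? M 8) , from-yes (17 ∣? M 8)) ((λ ()) , (λ ()) , (λ ()))

threePrimeDivisors-M[12] : ThreePrimeDivisors (M 12)
threePrimeDivisors-M[12] = divisors (from-yes (prime? 5) , from-yes (prime? 7) , from-yes (prime? 13))
  (from-yes (5 ∣? M 12) , from-yes (7 ∣? M 12) , from-yes (13 ∣? M 12)) ((λ ()) , (λ ()) , (λ ()))

threePrimeDivisors-M[18] : ThreePrimeDivisors (M 18)
threePrimeDivisors-M[18] = divisors (from-yes (prime? 7) , from-yes (prime? 19) , from-yes (prime? 73))
  (from-yes (7 ∣? M 18) , from-yes (19 ∣? M 18) , from-yes (73 ∣? M 18)) ((λ ()) , (λ ()) , (λ ()))

3≤ω[M] : ∀ {n d} .{{_ : NonZero n}} → d ∣ n → ThreePrimeDivisors (M d) → 3 ≤ ω (M n)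
3≤ω[M] {n} d∣n three = 3≤ω {{M-nonZero n}} (ThreePrimeDivisors-∣ (M-∣ d∣n) three)

3≤ω[M[6k]] : ∀ {n} .{{_ : NonZero n}} → n ≢ 6 → 6 ∣ n → 3 ≤ ω (M n)
3≤ω[M[6k]] {n} n≢6 (divides 0 refl) = contradiction refl (≢-nonZero⁻¹ n)
3≤ω[M[6k]] n≢6 (divides 1 refl) = contradiction refl n≢6
3≤ω[M[6k]] n≢6 (divides k@(suc (suc _)) refl) with prime-factor {k} (s≤s (s≤s z≤n))
... | r , r-prime , r∣k with r ≟ 2 | r ≟ 3
... | yes refl | _        = 3≤ω[M] (*-monoˡ-∣ 6 r∣k) threePrimeDivisors-M[12]
... | no _     | yes refl = 3≤ω[M] (*-monoˡ-∣ 6 r∣k) threePrimeDivisors-M[18]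
... | no r≢2   | no r≢3   =
  3≤ω[M] {d = 2 * r} (∣-trans (divides 3 (r*6≡3*[2*r] r)) (*-monoˡ-∣ 6 r∣k))
         (threePrimeDivisors-M[2p] r-prime (r≢2 ∘ sym ∘ prime∣prime⇒≡ prime[2] r-prime) r≢3)
  where
  r*6≡3*[2*r] : ∀ r → r * 6 ≡ 3 * (2 * r)
  r*6≡3*[2*r] = solve-∀

proposition3 : (n : ℕ) → NonZero n → n ≢ 6
    → ((∃ λ p₁ → Prime p₁ × p₁ ^ 3 ∣ n)
    ⊎ (∃ λ p₁ → ∃ λ p₂ → Prime p₁ × Prime p₂ × ¬ (2 ∣ p₁) × ¬ (2 ∣ p₂) × p₁ ≢ p₂ × p₁ * p₂ ∣ n)
    ⊎ (∃ λ p₁ → Prime p₁ × ¬ (2 ∣ p₁) × 2 * p₁ ∣ n))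
    → ω (M n) ≥ 3
proposition3 n n≢0 n≢6 (inj₁ (p , p-prime , p³∣n)) with p ≟ 2
... | yes refl = 3≤ω[M] {{n≢0}} p³∣n threePrimeDivisors-M[8]
... | no p≢2   = 3≤ω[M] {{n≢0}} p³∣n (threePrimeDivisors-M[p³] p-prime (p≢2 ∘ sym ∘ prime∣prime⇒≡ prime[2] p-prime))
proposition3 n n≢0 n≢6 (inj₂ (inj₁ (p₁ , p₂ , p₁-prime , p₂-prime , 2∤p₁ , 2∤p₂ , p₁≢p₂ , p₁p₂∣n))) =
  3≤ω[M] {{n≢0}} p₁p₂∣n (threePrimeDivisors-M[p₁p₂] p₁-prime p₂-prime 2∤p₁ 2∤p₂ p₁≢p₂)
proposition3 n n≢0 n≢6 (inj₂ (inj₂ (p , p-prime , 2∤p , 2p∣n))) with p ≟ 3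
... | yes refl = 3≤ω[M[6k]] {{n≢0}} n≢6 2p∣n
... | no p≢3   = 3≤ω[M] {{n≢0}} 2p∣n (threePrimeDivisors-M[2p] p-prime 2∤p p≢3)
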